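{- Let $G_1=(V_1,E_1)$ and $G_2=(V_2,E_2)$ be finite simple graphs, let $\delta_2$ be the minimum degree of $G_2$, and let $S_1\subseteq V_1$. If $S_1\times V_2$ is a $k$-daf set in $G_1\times G_2$, then $S_1$ is a $(k-\delta_2)$-daf set in $G_1$.
   Context: For a graph $G=(V,E)$, a set $S\subseteq V$ and $v\in V$, $\delta_S(v)=|\{u\in S: uv\in E\}|$ and $\overline{S}=V\setminus S$. For an integer $k$, a non-empty set $S\subseteq V$ is a defensive $k$-alliance if $\delta_S(v)\ge \delta_{\overline{S}}(v)+k$ for every $v\in S$. A set $X\subseteq V$ is defensive $k$-alliance free ($k$-daf) if $X$ contains no defensive $k$-alliance as a subset. The Cartesian product $G_1\times G_2$ has vertex set $V_1\times V_2$, with $(a,b)$ adjacent to $(c,d)$ iff either $a=c$ and $bd\in E_2$, or $b=d$ and $ac\in E_1$. -}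

module Defs where

open import Data.Nat using (ℕ; _*_)
open import Data.Integer using (ℤ; _+_; _-_; _≤_; +_)
open import Data.Bool using (Bool; true; false; _∧_; _∨_)
open import Data.Fin using (Fin; remQuot)
open import Data.Fin.Subset using (Subset; _∈_; _⊆_; _∩_; ∁; ∣_∣; Nonempty; ⁅_⁆)
open import Data.Fin.Properties using (_≟_)
open import Data.Vec using (tabulate)
import Data.Vec
open import Data.Product using (_×_; _,_; proj₁; proj₂; ∃)
open import Relation.Nullary using (¬_; yes; no)
open import Data.Empty using (⊥-elim)
import Data.Bool.Properties
open import Relation.Nullary.Decidable using (⌊_⌋)
open import Relation.Binary.PropositionalEquality using (_≡_; refl) renaming (sym to ≡-sym)

record Graph : Set where
  field
    n      : ℕ
    adj    : Fin n → Fin n → Bool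
    sym    : ∀ u v → adj u v ≡ adj v u
    irrefl : ∀ v → adj v v ≡ false
open Graph public

N : (G : Graph) → Fin (n G) → Subset (n G)
N G v = tabulate (adj G v)

deg : (G : Graph) → Fin (n G) → ℕ
deg G v = ∣ N G v ∣

IsMinDegree : (G : Graph) → ℕ → Set
IsMinDegree G δ = (∀ v → δ Data.Nat.≤ deg G v) × ∃ λ v → deg G v ≡ δ

δ[_] : (G : Graph) → Subset (n G) → Fin (n G) → ℕ
δ[ G ] S v = ∣ S ∩ N G v ∣

IsDefensiveAlliance : (G : Graph) → ℤ → Subset (n G) → Set
IsDefensiveAlliance G k S =
  Nonempty S × (∀ v → v ∈ S → + (δ[ G ] (∁ S) v) + k ≤ + (δ[ G ] S v))

IsDAF : (G : Graph) → ℤ → Subset (n G) → Set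
IsDAF G k X = ∀ S → S ⊆ X → ¬ IsDefensiveAlliance G k S

_□_ : Graph → Graph → Graph
G₁ □ G₂ = record
  { n = n G₁ * n G₂
  ; adj = λ i j → prodAdj (remQuot (n G₂) i) (remQuot (n G₂) j)
  ; sym = λ i j → prodSym (remQuot (n G₂) i) (remQuot (n G₂) j)
  ; irrefl = λ i → prodIrr (remQuot (n G₂) i)
  }
  where
  prodAdj : Fin (n G₁) × Fin (n G₂) → Fin (n G₁) × Fin (n G₂) → Bool
  prodAdj (a , b) (c , d) = (⌊ a ≟ c ⌋ ∧ adj G₂ b d) ∨ (⌊ b ≟ d ⌋ ∧ adj G₁ a c)
  eqSym : ∀ {m} (x y : Fin m) → ⌊ x ≟ y ⌋ ≡ ⌊ y ≟ x ⌋
  eqSym x y with x ≟ y | y ≟ x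
  ... | yes _ | yes _ = refl
  ... | no _  | no _  = refl
  ... | yes p | no q  = ⊥-elim (q (≡-sym p))
  ... | no p  | yes q = ⊥-elim (p (≡-sym q))
  prodSym : ∀ p q → prodAdj p q ≡ prodAdj q p
  prodSym (a , b) (c , d) rewrite eqSym a c | eqSym b d | sym G₂ b d | sym G₁ a c = refl
  prodIrr : ∀ p → prodAdj p p ≡ false
  prodIrr (a , b) rewrite irrefl G₁ a | irrefl G₂ b | Data.Bool.Properties.∧-zeroʳ ⌊ a ≟ a ⌋ | Data.Bool.Properties.∧-zeroʳ ⌊ b ≟ b ⌋ = refl

_×V[_] : {G₁ : Graph} → Subset (n G₁) → (G₂ : Graph) → Subset (n (G₁ □ G₂))
_×V[_] {G₁} S₁ G₂ = tabulate λ i → Data.Vec.lookup S₁ (proj₁ (remQuot (n G₂) i))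

-- We prove the contrapositive by lifting alliances: if S ⊆ S₁ is a
-- defensive (k - δ₂)-alliance of G₁, then S × V₂ ⊆ S₁ × V₂ is a defensive
-- k-alliance of G₁ □ G₂.  The heart of the argument is the neighbour count
-- in the product: for every T ⊆ V₁ and every vertex (c , d),
--     δ_{T × V₂}(c , d) = [c ∈ T] · deg₂(d) + δ_T(c),
-- since the neighbours of (c , d) are the (c , b) with b ~ d and the (a , d)
-- with a ~ c.  As ∁(S × V₂) = (∁ S) × V₂, a vertex (c , d) with c ∈ S gains
-- exactly deg₂(d) ≥ δ₂ neighbours inside the alliance and none outside it.
module Submission where

open import Defs
open import Data.Nat using (ℕ)
open import Data.Integer using (ℤ; _-_; +_)
open import Data.Fin.Subset using (Subset)

open import Data.Nat using (zero; suc; _+_; _*_; _≤_)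
import Data.Nat.Properties as ℕₚ
open import Data.Nat.Tactic.RingSolver using (solve-∀)
import Data.Integer as Int
import Data.Integer.Properties as Intₚ
open import Data.Bool using (Bool; true; false; _∧_; _∨_; not)
open import Data.Bool.Properties using (∧-zeroʳ)
open import Data.Fin using (Fin; zero; suc; combine; remQuot; _↑ˡ_; _↑ʳ_)
open import Data.Fin.Properties using (_≟_; remQuot-combine; combine-remQuot)
open import Data.Fin.Subset using (_∈_; _⊆_; _∩_; ∁; ∣_∣)
open import Data.Vec using ([]; _∷_; lookup)
open import Data.Vec.Properties
  using (lookup-zipWith; lookup-map; lookup∘tabulate; tabulate-∘; tabulate-cong; []=⇒lookup; lookup⇒[]=)
open import Data.Product using (_,_; proj₁; uncurry)
open import Relation.Nullary.Decidable using (⌊_⌋; yes; no)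
open import Relation.Binary.PropositionalEquality
  using (_≡_; refl; trans; cong; cong₂; subst; subst₂; module ≡-Reasoning)
  renaming (sym to ≡-sym)
open import Function using (_∘_)
open import Algebra.Properties.Semiring.Sum ℕₚ.+-*-semiring
  using (sum-syntax; sum-cong-≗; sum-replicate-zero; ∑-distrib-+; *-distribˡ-sum)

χ : Bool → ℕ
χ true  = 1
χ false = 0

χ-∧ : ∀ x y → χ (x ∧ y) ≡ χ x * χ y
χ-∧ true  y = ≡-sym (ℕₚ.+-identityʳ (χ y))
χ-∧ false y = refl

χ-∨ : ∀ x y → x ∧ y ≡ false → χ (x ∨ y) ≡ χ x + χ y
χ-∨ true  false _ = refl
χ-∨ false y     _ = refl

∧-disjoint : ∀ e A f B → e ∧ B ≡ false → (e ∧ A) ∧ (f ∧ B) ≡ false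
∧-disjoint false A f B _ = refl
∧-disjoint true  A f B B≡false rewrite B≡false | ∧-zeroʳ f = ∧-zeroʳ A

*-distrib-interchange : ∀ t e a f b → t * (e * a + f * b) ≡ e * (t * a) + f * (t * b)
*-distrib-interchange = solve-∀

∑-↑ : ∀ m k (f : Fin (m + k) → ℕ) →
  ∑[ i < m + k ] f i ≡ ∑[ i < m ] f (i ↑ˡ k) + ∑[ j < k ] f (m ↑ʳ j)
∑-↑ zero    k f = refl
∑-↑ (suc m) k f =
  trans (cong (λ s → f zero + s) (∑-↑ m k (f ∘ suc))) (≡-sym (ℕₚ.+-assoc (f zero) _ _))

∑-combine : ∀ m k (f : Fin (m * k) → ℕ) →
  ∑[ i < m * k ] f i ≡ ∑[ a < m ] ∑[ b < k ] f (combine a b)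
∑-combine zero    k f = refl
∑-combine (suc m) k f =
  trans (∑-↑ k (m * k) f) (cong (λ s → ∑[ b < k ] f (b ↑ˡ (m * k)) + s) (∑-combine m k (f ∘ (k ↑ʳ_))))

⌊suc≟suc⌋ : ∀ {n} (i j : Fin n) → ⌊ suc i ≟ suc j ⌋ ≡ ⌊ i ≟ j ⌋
⌊suc≟suc⌋ i j with i ≟ j
... | yes _ = refl
... | no  _ = refl

∑-δ : ∀ n (i : Fin n) (f : Fin n → ℕ) → ∑[ j < n ] (χ ⌊ i ≟ j ⌋ * f j) ≡ f i
∑-δ (suc n) zero    f =
  trans (cong₂ _+_ (ℕₚ.+-identityʳ (f zero)) (sum-replicate-zero n)) (ℕₚ.+-identityʳ (f zero))
∑-δ (suc n) (suc i) f =
  trans (sum-cong-≗ (λ j → cong (λ b → χ b * f (suc j)) (⌊suc≟suc⌋ i j))) (∑-δ n i (f ∘ suc))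

∣∣-as-∑ : ∀ {m} (p : Subset m) → ∣ p ∣ ≡ ∑[ i < m ] χ (lookup p i)
∣∣-as-∑ []          = refl
∣∣-as-∑ (true  ∷ p) = cong suc (∣∣-as-∑ p)
∣∣-as-∑ (false ∷ p) = ∣∣-as-∑ p

deg-as-∑ : ∀ G v → deg G v ≡ ∑[ u < n G ] χ (adj G v u)
deg-as-∑ G v =
  trans (∣∣-as-∑ (N G v)) (sum-cong-≗ (λ u → cong χ (lookup∘tabulate (adj G v) u)))

δ-as-∑ : ∀ G (T : Subset (n G)) v → δ[ G ] T v ≡ ∑[ u < n G ] (χ (lookup T u) * χ (adj G v u))
δ-as-∑ G T v = trans (∣∣-as-∑ (T ∩ N G v)) (sum-cong-≗ entry)
  where
  entry : ∀ u → χ (lookup (T ∩ N G v) u) ≡ χ (lookup T u) * χ (adj G v u)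
  entry u = begin
    χ (lookup (T ∩ N G v) u)
      ≡⟨ cong χ (lookup-zipWith _∧_ u T (N G v)) ⟩
    χ (lookup T u ∧ lookup (N G v) u)
      ≡⟨ cong (λ b → χ (lookup T u ∧ b)) (lookup∘tabulate (adj G v) u) ⟩
    χ (lookup T u ∧ adj G v u)
      ≡⟨ χ-∧ (lookup T u) (adj G v u) ⟩
    χ (lookup T u) * χ (adj G v u)
      ∎
    where open ≡-Reasoning

≟∧adj≡false : ∀ G (c a : Fin (n G)) → ⌊ c ≟ a ⌋ ∧ adj G c a ≡ false
≟∧adj≡false G c a with c ≟ a
... | yes refl = irrefl G c
... | no  _    = refl

module _ (G₁ G₂ : Graph) where

  private
    P  = G₁ □ G₂
    n₁ = n G₁
    n₂ = n G₂

  adj-□ : ∀ c a d b → adj P (combine c d) (combine a b)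
        ≡ ((⌊ c ≟ a ⌋ ∧ adj G₂ d b) ∨ (⌊ d ≟ b ⌋ ∧ adj G₁ c a))
  adj-□ c a d b =
    cong₂ adjPair (remQuot-combine {n₁} {n₂} c d) (remQuot-combine {n₁} {n₂} a b)
    where
    adjPair : _ → _ → Bool
    adjPair (c′ , d′) (a′ , b′) = (⌊ c′ ≟ a′ ⌋ ∧ adj G₂ d′ b′) ∨ (⌊ d′ ≟ b′ ⌋ ∧ adj G₁ c′ a′)

  lookup-×V : ∀ (T : Subset n₁) a b → lookup (_×V[_] {G₁} T G₂) (combine a b) ≡ lookup T a
  lookup-×V T a b = trans (lookup∘tabulate _ (combine a b))
                          (cong (lookup T ∘ proj₁) (remQuot-combine {n₁} {n₂} a b))

  ∁-×V : ∀ (T : Subset n₁) → ∁ (_×V[_] {G₁} T G₂) ≡ _×V[_] {G₁} (∁ T) G₂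
  ∁-×V T = trans (≡-sym (tabulate-∘ not _))
                 (tabulate-cong (λ i → ≡-sym (lookup-map (proj₁ (remQuot {n₁} n₂ i)) not T)))

  ×V-mono : ∀ {S T : Subset n₁} → S ⊆ T → _×V[_] {G₁} S G₂ ⊆ _×V[_] {G₁} T G₂
  ×V-mono {S} {T} S⊆T {i} i∈S×V = lookup⇒[]= i _ (trans (lookup∘tabulate _ i)
    ([]=⇒lookup (S⊆T (lookup⇒[]= _ S (trans (≡-sym (lookup∘tabulate _ i)) ([]=⇒lookup i∈S×V))))))

  ∀-combine : ∀ {ℓ} {Q : Fin (n P) → Set ℓ} → (∀ a b → Q (combine a b)) → ∀ i → Q i
  ∀-combine {Q = Q} h i = subst Q (combine-remQuot {n₁} n₂ i) (uncurry h (remQuot {n₁} n₂ i))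

  -- The neighbour count in the product, as a 0/1 decomposition of each term:
  -- (a , b) is a neighbour of (c , d) in T × V₂ either along G₂ (a = c) or
  -- along G₁ (b = d), never both since G₁ has no loops.
  neighbour-indicator : ∀ (T : Subset n₁) c d a b →
    χ (lookup (_×V[_] {G₁} T G₂ ∩ N P (combine c d)) (combine a b))
      ≡ χ ⌊ c ≟ a ⌋ * (χ (lookup T a) * χ (adj G₂ d b))
        + χ ⌊ d ≟ b ⌋ * (χ (lookup T a) * χ (adj G₁ c a))
  neighbour-indicator T c d a b = begin
    χ (lookup (X ∩ N P (combine c d)) (combine a b))
      ≡⟨ cong χ (trans (lookup-zipWith _∧_ (combine a b) X (N P (combine c d)))
                       (cong₂ _∧_ (lookup-×V T a b)
                                  (trans (lookup∘tabulate _ (combine a b)) (adj-□ c a d b)))) ⟩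
    χ (t ∧ ((e ∧ A) ∨ (f ∧ B)))
      ≡⟨ χ-∧ t _ ⟩
    χ t * χ ((e ∧ A) ∨ (f ∧ B))
      ≡⟨ cong (χ t *_) (trans (χ-∨ (e ∧ A) (f ∧ B) (∧-disjoint e A f B (≟∧adj≡false G₁ c a)))
                              (cong₂ _+_ (χ-∧ e A) (χ-∧ f B))) ⟩
    χ t * (χ e * χ A + χ f * χ B)
      ≡⟨ *-distrib-interchange (χ t) (χ e) (χ A) (χ f) (χ B) ⟩
    χ e * (χ t * χ A) + χ f * (χ t * χ B)
      ∎
    where
    open ≡-Reasoning
    X = _×V[_] {G₁} T G₂
    t = lookup T a
    e = ⌊ c ≟ a ⌋
    A = adj G₂ d b
    f = ⌊ d ≟ b ⌋
    B = adj G₁ c a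

  δ-×V : ∀ (T : Subset n₁) c d →
    δ[ P ] (_×V[_] {G₁} T G₂) (combine c d) ≡ χ (lookup T c) * deg G₂ d + δ[ G₁ ] T c
  δ-×V T c d = begin
    δ[ P ] X (combine c d)
      ≡⟨ ∣∣-as-∑ (X ∩ N P (combine c d)) ⟩
    ∑[ i < n₁ * n₂ ] χ (lookup (X ∩ N P (combine c d)) i)
      ≡⟨ ∑-combine n₁ n₂ _ ⟩
    ∑[ a < n₁ ] ∑[ b < n₂ ] χ (lookup (X ∩ N P (combine c d)) (combine a b))
      ≡⟨ sum-cong-≗ (λ a → trans (sum-cong-≗ (neighbour-indicator T c d a))
                                 (∑-distrib-+ (viaG₂ a) (viaG₁ a))) ⟩
    ∑[ a < n₁ ] (∑[ b < n₂ ] viaG₂ a b + ∑[ b < n₂ ] viaG₁ a b)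
      ≡⟨ sum-cong-≗ (λ a → cong₂ _+_ (alongG₂ a) (∑-δ n₂ d _)) ⟩
    ∑[ a < n₁ ] (χ ⌊ c ≟ a ⌋ * (χ (lookup T a) * deg G₂ d) + χ (lookup T a) * χ (adj G₁ c a))
      ≡⟨ ∑-distrib-+ (λ a → χ ⌊ c ≟ a ⌋ * (χ (lookup T a) * deg G₂ d))
                     (λ a → χ (lookup T a) * χ (adj G₁ c a)) ⟩
    ∑[ a < n₁ ] (χ ⌊ c ≟ a ⌋ * (χ (lookup T a) * deg G₂ d))
      + ∑[ a < n₁ ] (χ (lookup T a) * χ (adj G₁ c a))
      ≡⟨ cong₂ _+_ (∑-δ n₁ c _) (≡-sym (δ-as-∑ G₁ T c)) ⟩
    χ (lookup T c) * deg G₂ d + δ[ G₁ ] T c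
      ∎
    where
    open ≡-Reasoning
    X = _×V[_] {G₁} T G₂
    viaG₂ viaG₁ : Fin n₁ → Fin n₂ → ℕ
    viaG₂ a b = χ ⌊ c ≟ a ⌋ * (χ (lookup T a) * χ (adj G₂ d b))
    viaG₁ a b = χ ⌊ d ≟ b ⌋ * (χ (lookup T a) * χ (adj G₁ c a))
    alongG₂ : ∀ a → ∑[ b < n₂ ] viaG₂ a b ≡ χ ⌊ c ≟ a ⌋ * (χ (lookup T a) * deg G₂ d)
    alongG₂ a = begin
      ∑[ b < n₂ ] viaG₂ a b
        ≡⟨ ≡-sym (*-distribˡ-sum (χ ⌊ c ≟ a ⌋) (λ b → χ (lookup T a) * χ (adj G₂ d b))) ⟩
      χ ⌊ c ≟ a ⌋ * ∑[ b < n₂ ] (χ (lookup T a) * χ (adj G₂ d b))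
        ≡⟨ cong (λ m → χ ⌊ c ≟ a ⌋ * m) (≡-sym (*-distribˡ-sum (χ (lookup T a)) (λ b → χ (adj G₂ d b)))) ⟩
      χ ⌊ c ≟ a ⌋ * (χ (lookup T a) * ∑[ b < n₂ ] χ (adj G₂ d b))
        ≡⟨ cong (λ m → χ ⌊ c ≟ a ⌋ * (χ (lookup T a) * m)) (≡-sym (deg-as-∑ G₂ d)) ⟩
      χ ⌊ c ≟ a ⌋ * (χ (lookup T a) * deg G₂ d)
        ∎

raise-threshold : ∀ (x y k d D : ℤ) → x Int.+ (k - d) Int.≤ y → d Int.≤ D →
                  x Int.+ k Int.≤ D Int.+ y
raise-threshold x y k d D h d≤D = begin
  x Int.+ k                 ≡⟨ regroup ⟩
  x Int.+ (k - d) Int.+ d   ≤⟨ Intₚ.+-monoˡ-≤ d h ⟩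
  y Int.+ d                 ≤⟨ Intₚ.+-monoʳ-≤ y d≤D ⟩
  y Int.+ D                 ≡⟨ Intₚ.+-comm y D ⟩
  D Int.+ y                 ∎
  where
  open Intₚ.≤-Reasoning
  regroup : x Int.+ k ≡ x Int.+ (k - d) Int.+ d
  regroup = ≡-sym (begin-equality
    x Int.+ (k - d) Int.+ d
      ≡⟨ Intₚ.+-assoc x (k - d) d ⟩
    x Int.+ (k - d Int.+ d)
      ≡⟨ cong (λ z → x Int.+ z) (Intₚ.+-assoc k (Int.- d) d) ⟩
    x Int.+ (k Int.+ (Int.- d Int.+ d))
      ≡⟨ cong (λ z → x Int.+ (k Int.+ z)) (Intₚ.+-inverseˡ d) ⟩
    x Int.+ (k Int.+ Int.0ℤ)
      ≡⟨ cong (λ z → x Int.+ z) (Intₚ.+-identityʳ k) ⟩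
    x Int.+ k
      ∎)

lift-alliance : ∀ (G₁ G₂ : Graph) (δ₂ : ℕ) → (∀ v → δ₂ ≤ deg G₂ v) → Fin (n G₂) →
  ∀ k (S : Subset (n G₁)) → IsDefensiveAlliance G₁ (k - + δ₂) S →
  IsDefensiveAlliance (G₁ □ G₂) k (_×V[_] {G₁} S G₂)
lift-alliance G₁ G₂ δ₂ δ₂≤deg b₀ k S ((a₀ , a₀∈S) , defends) =
  (combine a₀ b₀ , member a₀ b₀ a₀∈S) , ∀-combine G₁ G₂ defends-at
  where
  S′ = _×V[_] {G₁} S G₂
  member : ∀ a b → a ∈ S → combine a b ∈ S′
  member a b a∈S = lookup⇒[]= _ S′ (trans (lookup-×V G₁ G₂ S a b) ([]=⇒lookup a∈S))
  defends-at : ∀ c d → combine c d ∈ S′ →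
    + δ[ G₁ □ G₂ ] (∁ S′) (combine c d) Int.+ k Int.≤ + δ[ G₁ □ G₂ ] S′ (combine c d)
  defends-at c d c,d∈S′ =
    subst₂ (λ out inn → + out Int.+ k Int.≤ + inn) (≡-sym outside) (≡-sym inside)
      (raise-threshold (+ δ[ G₁ ] (∁ S) c) (+ δ[ G₁ ] S c) k (+ δ₂) (+ deg G₂ d)
        (defends c (lookup⇒[]= c S c∈S)) (Int.+≤+ (δ₂≤deg d)))
    where
    c∈S : lookup S c ≡ true
    c∈S = trans (≡-sym (lookup-×V G₁ G₂ S c d)) ([]=⇒lookup c,d∈S′)
    outside : δ[ G₁ □ G₂ ] (∁ S′) (combine c d) ≡ δ[ G₁ ] (∁ S) c
    outside = begin
      δ[ G₁ □ G₂ ] (∁ S′) (combine c d)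
        ≡⟨ cong (λ X → δ[ G₁ □ G₂ ] X (combine c d)) (∁-×V G₁ G₂ S) ⟩
      δ[ G₁ □ G₂ ] (_×V[_] {G₁} (∁ S) G₂) (combine c d)
        ≡⟨ δ-×V G₁ G₂ (∁ S) c d ⟩
      χ (lookup (∁ S) c) * deg G₂ d + δ[ G₁ ] (∁ S) c
        ≡⟨ cong (λ b → χ b * deg G₂ d + δ[ G₁ ] (∁ S) c) (trans (lookup-map c not S) (cong not c∈S)) ⟩
      δ[ G₁ ] (∁ S) c
        ∎
      where open ≡-Reasoning
    inside : δ[ G₁ □ G₂ ] S′ (combine c d) ≡ deg G₂ d + δ[ G₁ ] S c
    inside = begin
      δ[ G₁ □ G₂ ] S′ (combine c d)
        ≡⟨ δ-×V G₁ G₂ S c d ⟩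
      χ (lookup S c) * deg G₂ d + δ[ G₁ ] S c
        ≡⟨ cong (λ b → χ b * deg G₂ d + δ[ G₁ ] S c) c∈S ⟩
      1 * deg G₂ d + δ[ G₁ ] S c
        ≡⟨ cong (λ m → m + δ[ G₁ ] S c) (ℕₚ.*-identityˡ (deg G₂ d)) ⟩
      deg G₂ d + δ[ G₁ ] S c
        ∎
      where open ≡-Reasoning

corollary8 : (G₁ G₂ : Graph) (δ₂ : ℕ) → IsMinDegree G₂ δ₂ → (k : ℤ) →
    (S₁ : Subset (n G₁)) →
    IsDAF (G₁ □ G₂) k (_×V[_] {G₁} S₁ G₂) →
    IsDAF G₁ (k - + δ₂) S₁
corollary8 G₁ G₂ δ₂ (δ₂≤deg , (b₀ , _)) k S₁ S₁×V-free S S⊆S₁ S-alliance =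
  S₁×V-free (_×V[_] {G₁} S G₂) (×V-mono G₁ G₂ S⊆S₁)
            (lift-alliance G₁ G₂ δ₂ δ₂≤deg b₀ k S S-alliance)
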